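{- Let $M\in\mathbb{Z}^{m\times n}$. Then the $\le_R$-minimum of the set $\{M\}\cup\{\mathrm{Ord}(\mathrm{Neg}(PM)) : P\in \mathrm{Mon}(m)\}$ equals $\mathrm{Min}(M)$, the minimal matrix in the Hadamard equivalence class of $M$. In other words, the procedure MINCLASS, which initializes $\mathrm{Min}\gets M$ and for each $P\in\mathrm{Mon}(m)$ computes $N=\mathrm{Ord}(\mathrm{Neg}(PM))$ and replaces $\mathrm{Min}$ by $N$ whenever $N<_R\mathrm{Min}$, returns $\mathrm{Min}(M)$.
   Context: Integer vectors are ordered lexicographically: $v<w$ iff there is $j$ with $v_i=w_i$ for all $i<j$ and $v_j<w_j$. The row-lex ordering $\le_R$ on $\mathbb{Z}^{m\times n}$ is the lexicographic extension of this ordering to matrices viewed as the sequence of their rows. Two matrices are Hadamard equivalent if one is obtained from the other by a sequence of row/column negations and row/column swaps; $\mathrm{Min}(M)$ is the $\le_R$-minimum of the Hadamard class of $M$. $\mathrm{Mon}(m)$ is the set of all $m\times m$ monomial matrices with entries in $\{0,-1,1\}$ (signed permutation matrices). A vector begins with a positive entry if its first nonzero entry is positive. $\mathrm{Neg}(N)$ is the matrix obtained from $N$ by negating each column that begins with a positive entry. $\mathrm{Ord}(N)$ is the matrix obtained from $N$ by permuting its columns so that they appear from left to right in increasing lexicographic order (columns read top to bottom). -}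

module Defs where

open import Data.Nat using (ℕ; zero; suc)
open import Data.Integer using (ℤ; +_; -[1+_]; _+_; _*_; -_; 0ℤ; 1ℤ; -1ℤ) renaming (_<_ to _<ℤ_)
open import Data.Fin using (Fin)
open import Data.Vec using (Vec; []; _∷_; lookup; tabulate; map; transpose; foldr′)
open import Data.Bool using (Bool; true; false; if_then_else_)
open import Data.Product using (Σ; ∃; _×_; _,_)
open import Data.Sum using (_⊎_)
open import Relation.Binary.PropositionalEquality using (_≡_)
open import Relation.Nullary using (¬_)
open import Relation.Binary.Construct.Closure.ReflexiveTransitive using (Star)

Matrix : ℕ → ℕ → Set
Matrix m n = Vec (Vec ℤ n) m

entry : ∀ {m n} → Matrix m n → Fin m → Fin n → ℤ
entry M i j = lookup (lookup M i) j

mk : ∀ {m n} → (Fin m → Fin n → ℤ) → Matrix m n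
mk f = tabulate λ i → tabulate λ j → f i j

col : ∀ {m n} → Matrix m n → Fin n → Vec ℤ m
col M j = map (λ r → lookup r j) M

Lex< : ∀ {A : Set} → (A → A → Set) → ∀ {k} → Vec A k → Vec A k → Set
Lex< _<_ [] [] = Data.Empty.⊥
  where import Data.Empty
Lex< _<_ (x ∷ xs) (y ∷ ys) = (x < y) ⊎ (x ≡ y × Lex< _<_ xs ys)

_<ᵥ_ : ∀ {k} → Vec ℤ k → Vec ℤ k → Set
_<ᵥ_ = Lex< _<ℤ_

_<R_ : ∀ {m n} → Matrix m n → Matrix m n → Set
_<R_ = Lex< _<ᵥ_

_≤R_ : ∀ {m n} → Matrix m n → Matrix m n → Set
M ≤R N = M <R N ⊎ M ≡ N

negRow : ∀ {m n} → Fin m → Matrix m n → Matrix m n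
negRow i₀ M = mk λ i j → if isYes (i Data.Fin.≟ i₀) then - entry M i j else entry M i j
  where open import Relation.Nullary.Decidable using (isYes)
        import Data.Fin

negCol : ∀ {m n} → Fin n → Matrix m n → Matrix m n
negCol j₀ M = mk λ i j → if isYes (j Data.Fin.≟ j₀) then - entry M i j else entry M i j
  where open import Relation.Nullary.Decidable using (isYes)
        import Data.Fin

swapIdx : ∀ {k} → Fin k → Fin k → Fin k → Fin k
swapIdx a b x = if isYes (x Data.Fin.≟ a) then b else (if isYes (x Data.Fin.≟ b) then a else x)
  where open import Relation.Nullary.Decidable using (isYes)
        import Data.Fin

swapRows : ∀ {m n} → Fin m → Fin m → Matrix m n → Matrix m n
swapRows a b M = mk λ i j → entry M (swapIdx a b i) j

swapCols : ∀ {m n} → Fin n → Fin n → Matrix m n → Matrix m n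
swapCols a b M = mk λ i j → entry M i (swapIdx a b j)

data HadStep {m n : ℕ} : Matrix m n → Matrix m n → Set where
  negR  : ∀ M i → HadStep M (negRow i M)
  negC  : ∀ M j → HadStep M (negCol j M)
  swapR : ∀ M a b → HadStep M (swapRows a b M)
  swapC : ∀ M a b → HadStep M (swapCols a b M)

HadEquiv : ∀ {m n} → Matrix m n → Matrix m n → Set
HadEquiv = Star HadStep

IsLeast : ∀ {m n} → (Matrix m n → Set) → Matrix m n → Set
IsLeast S N = S N × (∀ N′ → S N′ → N ≤R N′)

IsMinClass : ∀ {m n} → Matrix m n → Matrix m n → Set
IsMinClass M N = IsLeast (HadEquiv M) N

IsSign : ℤ → Set
IsSign x = x ≡ 0ℤ ⊎ x ≡ 1ℤ ⊎ x ≡ -1ℤ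

IsMonomial : ∀ {m} → Matrix m m → Set
IsMonomial {m} P =
  (∀ i j → IsSign (entry P i j)) ×
  (∀ i → Σ (Fin m) λ j → ¬ entry P i j ≡ 0ℤ × (∀ j′ → ¬ entry P i j′ ≡ 0ℤ → j′ ≡ j)) ×
  (∀ j → Σ (Fin m) λ i → ¬ entry P i j ≡ 0ℤ × (∀ i′ → ¬ entry P i′ j ≡ 0ℤ → i′ ≡ i))

sumℤ : ∀ {k} → Vec ℤ k → ℤ
sumℤ = foldr′ _+_ 0ℤ

_·_ : ∀ {m k n} → Matrix m k → Matrix k n → Matrix m n
P · M = mk λ i j → sumℤ (tabulate λ l → entry P i l * entry M l j)

beginsPositive : ∀ {k} → Vec ℤ k → Bool
beginsPositive [] = false
beginsPositive ((+ zero) ∷ xs) = beginsPositive xs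
beginsPositive ((+ suc _) ∷ xs) = true
beginsPositive (-[1+ _ ] ∷ xs) = false

Neg : ∀ {m n} → Matrix m n → Matrix m n
Neg N = mk λ i j → if beginsPositive (col N j) then - entry N i j else entry N i j

ltℤᵇ : ℤ → ℤ → Bool
ltℤᵇ x y = isYes (x Data.Integer.<? y)
  where open import Relation.Nullary.Decidable using (isYes)
        import Data.Integer

leqᵥᵇ : ∀ {k} → Vec ℤ k → Vec ℤ k → Bool
leqᵥᵇ [] [] = true
leqᵥᵇ (x ∷ xs) (y ∷ ys) = if ltℤᵇ x y then true else (if ltℤᵇ y x then false else leqᵥᵇ xs ys)

insertSorted : ∀ {k c} → Vec ℤ k → Vec (Vec ℤ k) c → Vec (Vec ℤ k) (suc c)
insertSorted v [] = v ∷ []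
insertSorted v (w ∷ ws) = if leqᵥᵇ v w then v ∷ w ∷ ws else w ∷ insertSorted v ws

sortVecs : ∀ {k c} → Vec (Vec ℤ k) c → Vec (Vec ℤ k) c
sortVecs [] = []
sortVecs (v ∷ vs) = insertSorted v (sortVecs vs)

Ord : ∀ {m n} → Matrix m n → Matrix m n
Ord N = transpose (sortVecs (transpose N))

Candidates : ∀ {m n} → Matrix m n → Matrix m n → Set
Candidates {m} M N = N ≡ M ⊎ Σ (Matrix m m) λ P → IsMonomial P × N ≡ Ord (Neg (P · M))

{-# OPTIONS --safe #-}

-- Neg and Ord are both realised by column operations, and neither raises a matrix in
-- row-lex order: Neg only negates columns whose first nonzero entry is positive, so the
-- first row meeting such a column nonzero strictly decreases, and insertion sort only moves
-- a column w in front of a column v with w < v, which lowers the first row where v and w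
-- differ. So Ord (Neg X) is Hadamard equivalent to X and below it. Conversely every X in the
-- Hadamard class of M is P M Q for signed permutation matrices P and Q, and
-- Ord (Neg (P M Q)) = Ord (Neg (P M)), because Ord ∘ Neg only sees the multiset of columns up
-- to sign. Hence the least among M and the Ord (Neg (P M)), P monomial, lies in the class and
-- below every member of it. The monomial P are enumerated as the {0, ±1}-matrices passing a
-- decidable test.

module Submission where

open import Defs
open import Data.Nat using (ℕ; zero; suc)
open import Data.Integer using (ℤ; +_; -[1+_]; -_; _+_; _*_; 0ℤ; 1ℤ; -1ℤ; _<?_)
import Data.Integer as ℤ
import Data.Integer.Properties as ℤ
open import Data.Fin using (Fin; zero; suc; _≟_; punchIn; punchOut)
open import Data.Fin.Properties using (all?; any?; suc-injective; punchIn-punchOut; punchOut-injective)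
open import Data.Fin.Permutation as Perm using (Permutation′; _⟨$⟩ʳ_; _⟨$⟩ˡ_; _∘ₚ_)
open import Data.Vec using (Vec; []; _∷_; lookup; tabulate; map; transpose; zipWith; toList)
open import Data.Vec.Properties
  using (tabulate∘lookup; lookup∘tabulate; tabulate-cong; lookup-map; lookup-zipWith; zipWith-is-⊛;
         lookup-replicate; map-id; map-∘; map-cong; toList-injective; cast-is-id)
open import Data.Vec.Relation.Binary.Pointwise.Extensional using (ext; Pointwise-≡⇒≡)
open import Data.List using (List)
import Data.List as List
open import Data.List.Membership.Propositional using (_∈_)
open import Data.List.Membership.Propositional.Properties
  using (∈-cartesianProductWith⁺; ∈-map⁺; ∈-map⁻; ∈-filter⁺; ∈-filter⁻)
open import Data.List.Relation.Unary.Any using (here; there)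
import Data.List.Relation.Unary.All as All
import Data.List.Relation.Binary.Pointwise as ListPointwise
import Data.List.Extrema
import Data.List.Sort.InsertionSort.Base
import Data.List.Sort.InsertionSort.Properties
open import Data.Bool using (Bool; true; false; if_then_else_; T; _xor_)
open import Data.Product using (∃; ∃₂; _×_; _,_; proj₁; proj₂)
open import Data.Sum using (_⊎_; inj₁; inj₂)
import Data.Sum as Sum
open import Data.Empty using (⊥-elim)
open import Function using (_∘_; id)
open import Function.Definitions using (Injective)
open import Function.Bundles using (Injection)
open import Function.Properties.Inverse using (↔⇒↣)
open import Relation.Binary.Definitions using (Transitive; Tri; tri<; tri≈; tri>)
open import Relation.Binary.Structures using (IsStrictTotalOrder)
open import Relation.Binary.Structures.Biased using (isStrictTotalOrderᶜ)
open import Relation.Binary.Bundles using (TotalOrder; DecTotalOrder)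
import Relation.Binary.Construct.StrictToNonStrict as StrictToNonStrict
import Relation.Binary.Reasoning.PartialOrder
open import Relation.Binary.PropositionalEquality
  using (_≡_; _≢_; refl; cong; cong₂; sym; trans; subst; isEquivalence; module ≡-Reasoning)
open import Relation.Binary.Construct.Closure.ReflexiveTransitive using (Star; ε; _◅_; _◅◅_; gmap)
open import Relation.Nullary using (Dec; yes; no; _because_; ¬_)
open import Relation.Nullary.Reflects using (Reflects; ofʸ; ofⁿ)
open import Relation.Nullary.Decidable using (isYes; _×-dec_; _⊎-dec_; _→-dec_; ¬?)

private variable
  m n k c : ℕ

-- Lexicographic orders

module _ {A : Set} {_<_ : A → A → Set} where

  Lex<-irrefl : (∀ {x} → ¬ x < x) → ∀ {xs : Vec A k} → ¬ Lex< _<_ xs xs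
  Lex<-irrefl <-irrefl {_ ∷ _} (inj₁ x<x) = <-irrefl x<x
  Lex<-irrefl <-irrefl {_ ∷ _} (inj₂ (_ , xs<xs)) = Lex<-irrefl <-irrefl xs<xs

  Lex<-trans : Transitive _<_ → Transitive (Lex< _<_ {k})
  Lex<-trans <-trans {[]} {[]} {[]} ()
  Lex<-trans <-trans {_ ∷ _} {_ ∷ _} {_ ∷ _} (inj₁ x<y) (inj₁ y<z) = inj₁ (<-trans x<y y<z)
  Lex<-trans <-trans {_ ∷ _} {_ ∷ _} {_ ∷ _} (inj₁ x<y) (inj₂ (refl , _)) = inj₁ x<y
  Lex<-trans <-trans {_ ∷ _} {_ ∷ _} {_ ∷ _} (inj₂ (refl , _)) (inj₁ y<z) = inj₁ y<z
  Lex<-trans <-trans {_ ∷ _} {_ ∷ _} {_ ∷ _} (inj₂ (refl , xs<ys)) (inj₂ (refl , ys<zs)) =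
    inj₂ (refl , Lex<-trans <-trans xs<ys ys<zs)

  Lex<-connected : (∀ x y → x < y ⊎ x ≡ y ⊎ y < x) →
                   (xs ys : Vec A k) → Lex< _<_ xs ys ⊎ xs ≡ ys ⊎ Lex< _<_ ys xs
  Lex<-connected cmp [] [] = inj₂ (inj₁ refl)
  Lex<-connected cmp (x ∷ xs) (y ∷ ys) with cmp x y
  ... | inj₁ x<y = inj₁ (inj₁ x<y)
  ... | inj₂ (inj₂ y<x) = inj₂ (inj₂ (inj₁ y<x))
  ... | inj₂ (inj₁ refl) with Lex<-connected cmp xs ys
  ...   | inj₁ xs<ys = inj₁ (inj₂ (refl , xs<ys))
  ...   | inj₂ (inj₁ refl) = inj₂ (inj₁ refl)
  ...   | inj₂ (inj₂ ys<xs) = inj₂ (inj₂ (inj₂ (refl , ys<xs)))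

  Lex<-isStrictTotalOrder : IsStrictTotalOrder _≡_ _<_ → IsStrictTotalOrder _≡_ (Lex< _<_ {k})
  Lex<-isStrictTotalOrder sto = isStrictTotalOrderᶜ record
    { isEquivalence = isEquivalence
    ; trans = Lex<-trans <-trans
    ; compare = λ xs ys → trichotomy (Lex<-connected connected xs ys)
    }
    where
    open IsStrictTotalOrder sto using (irrefl; compare) renaming (trans to <-trans)
    connected : ∀ x y → x < y ⊎ x ≡ y ⊎ y < x
    connected x y with compare x y
    ... | tri< x<y _ _ = inj₁ x<y
    ... | tri≈ _ x≡y _ = inj₂ (inj₁ x≡y)
    ... | tri> _ _ y<x = inj₂ (inj₂ y<x)
    lex-irrefl : ∀ {xs : Vec A k} → ¬ Lex< _<_ xs xs
    lex-irrefl = Lex<-irrefl (irrefl refl)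
    lex-asym : ∀ {xs ys : Vec A k} → Lex< _<_ xs ys → ¬ Lex< _<_ ys xs
    lex-asym xs<ys ys<xs = lex-irrefl (Lex<-trans <-trans xs<ys ys<xs)
    trichotomy : ∀ {xs ys} → Lex< _<_ xs ys ⊎ xs ≡ ys ⊎ Lex< _<_ ys xs →
                 Tri (Lex< _<_ xs ys) (xs ≡ ys) (Lex< _<_ ys xs)
    trichotomy (inj₁ xs<ys) = tri< xs<ys (λ { refl → lex-irrefl xs<ys }) (lex-asym xs<ys)
    trichotomy (inj₂ (inj₁ refl)) = tri≈ lex-irrefl refl lex-irrefl
    trichotomy (inj₂ (inj₂ ys<xs)) =
      tri> (λ xs<ys → lex-asym xs<ys ys<xs) (λ { refl → lex-irrefl ys<xs }) ys<xs

<ᵥ-isStrictTotalOrder : IsStrictTotalOrder _≡_ (_<ᵥ_ {k})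
<ᵥ-isStrictTotalOrder = Lex<-isStrictTotalOrder ℤ.<-isStrictTotalOrder

<R-isStrictTotalOrder : IsStrictTotalOrder _≡_ (_<R_ {m} {n})
<R-isStrictTotalOrder = Lex<-isStrictTotalOrder <ᵥ-isStrictTotalOrder

≤R-totalOrder : ℕ → ℕ → TotalOrder _ _ _
≤R-totalOrder m n = record
  { Carrier = Matrix m n
  ; _≈_ = _≡_
  ; _≤_ = _≤R_
  ; isTotalOrder = StrictToNonStrict.isTotalOrder _≡_ _<R_ <R-isStrictTotalOrder
  }

module ≤R-Reasoning {m n : ℕ} =
  Relation.Binary.Reasoning.PartialOrder (TotalOrder.poset (≤R-totalOrder m n))

_≤ᵥ_ : Vec ℤ k → Vec ℤ k → Set
u ≤ᵥ v = u <ᵥ v ⊎ u ≡ v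

leqᵥᵇ-reflects : (u v : Vec ℤ k) → Reflects (u ≤ᵥ v) (leqᵥᵇ u v)
leqᵥᵇ-reflects [] [] = ofʸ (inj₂ refl)
leqᵥᵇ-reflects (x ∷ u) (y ∷ v) with x <? y | y <? x
... | yes x<y | _ = ofʸ (inj₁ (inj₁ x<y))
... | no x≮y | yes y<x = ofⁿ λ
  { (inj₁ (inj₁ x<y)) → x≮y x<y
  ; (inj₁ (inj₂ (refl , _))) → ℤ.<-irrefl refl y<x
  ; (inj₂ refl) → ℤ.<-irrefl refl y<x
  }
... | no x≮y | no y≮x with ℤ.≤-antisym (ℤ.≮⇒≥ y≮x) (ℤ.≮⇒≥ x≮y)
...   | refl with leqᵥᵇ u v | leqᵥᵇ-reflects u v
...     | true | ofʸ u≤v = ofʸ (Sum.map (λ u<v → inj₂ (refl , u<v)) (cong (x ∷_)) u≤v)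
...     | false | ofⁿ u≰v = ofⁿ λ
  { (inj₁ (inj₁ x<x)) → x≮y x<x
  ; (inj₁ (inj₂ (_ , u<v))) → u≰v (inj₁ u<v)
  ; (inj₂ refl) → u≰v (inj₂ refl)
  }

-- The decision procedure has leqᵥᵇ as its boolean, so the library's insertion sort is sortVecs.
≤ᵥ-decTotalOrder : ℕ → DecTotalOrder _ _ _
≤ᵥ-decTotalOrder k = record
  { Carrier = Vec ℤ k
  ; _≈_ = _≡_
  ; _≤_ = _≤ᵥ_
  ; isDecTotalOrder = record
    { isTotalOrder = StrictToNonStrict.isTotalOrder _≡_ _<ᵥ_ <ᵥ-isStrictTotalOrder
    ; _≟_ = IsStrictTotalOrder._≟_ <ᵥ-isStrictTotalOrder
    ; _≤?_ = λ u v → leqᵥᵇ u v because leqᵥᵇ-reflects u v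
    }
  }

-- Insertion sort and permutations of vectors

module _ {k : ℕ} where
  open Data.List.Sort.InsertionSort.Base (≤ᵥ-decTotalOrder k) using (insert)
  open Data.List.Sort.InsertionSort.Properties (≤ᵥ-decTotalOrder k) using (insert-swap)

  toList-insertSorted : ∀ {c} (v : Vec ℤ k) (ws : Vec (Vec ℤ k) c) →
                        toList (insertSorted v ws) ≡ insert v (toList ws)
  toList-insertSorted v [] = refl
  toList-insertSorted v (w ∷ ws) with leqᵥᵇ v w
  ... | true = refl
  ... | false = cong (w List.∷_) (toList-insertSorted v ws)

  insertSorted-comm : ∀ {c} (u v : Vec ℤ k) (ws : Vec (Vec ℤ k) c) →
                      insertSorted u (insertSorted v ws) ≡ insertSorted v (insertSorted u ws)
  insertSorted-comm u v ws = trans (sym (cast-is-id refl _)) (toList-injective refl _ _ (begin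
    toList (insertSorted u (insertSorted v ws))
      ≡⟨ toList-insertSorted u (insertSorted v ws) ⟩
    insert u (toList (insertSorted v ws))
      ≡⟨ cong (insert u) (toList-insertSorted v ws) ⟩
    insert u (insert v (toList ws))
      ≡⟨ ListPointwise.Pointwise-≡⇒≡ (insert-swap u v (toList ws)) ⟩
    insert v (insert u (toList ws))
      ≡⟨ cong (insert v) (toList-insertSorted u ws) ⟨
    insert v (toList (insertSorted u ws))
      ≡⟨ toList-insertSorted v (insertSorted u ws) ⟨
    toList (insertSorted v (insertSorted u ws)) ∎))
    where open ≡-Reasoning

infix 4 _↭_

data _↭_ {A : Set} : Vec A n → Vec A n → Set where
  ↭-refl  : {xs : Vec A n} → xs ↭ xs
  ↭-prep  : (x : A) {xs ys : Vec A n} → xs ↭ ys → x ∷ xs ↭ x ∷ ys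
  ↭-swap  : (x y : A) (xs : Vec A n) → x ∷ y ∷ xs ↭ y ∷ x ∷ xs
  ↭-trans : {xs ys zs : Vec A n} → xs ↭ ys → ys ↭ zs → xs ↭ zs

↭-reflexive : {A : Set} {xs ys : Vec A n} → xs ≡ ys → xs ↭ ys
↭-reflexive refl = ↭-refl

module _ {A : Set} where

  ↭-punchIn : (v : Vec A (suc n)) (a : Fin (suc n)) →
              v ↭ lookup v a ∷ tabulate (lookup v ∘ punchIn a)
  ↭-punchIn (x ∷ xs) zero = ↭-prep x (↭-reflexive (sym (tabulate∘lookup xs)))
  ↭-punchIn (x ∷ y ∷ xs) (suc a) =
    ↭-trans (↭-prep x (↭-punchIn (y ∷ xs) a)) (↭-swap x (lookup (y ∷ xs) a) _)

  ↭-tabulate : (v : Vec A n) {π : Fin n → Fin n} → Injective _≡_ _≡_ π →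
               v ↭ tabulate (lookup v ∘ π)
  ↭-tabulate {zero} [] _ = ↭-refl
  ↭-tabulate {suc n} v {π} π-inj =
    ↭-trans (↭-punchIn v a)
            (↭-prep (lookup v a) (↭-trans (↭-tabulate w σ-inj) (↭-reflexive (tabulate-cong lookup-w∘σ))))
    where
    a : Fin (suc n)
    a = π zero
    a≢π∘suc : ∀ i → a ≢ π (suc i)
    a≢π∘suc i eq with π-inj eq
    ... | ()
    σ : Fin n → Fin n
    σ i = punchOut (a≢π∘suc i)
    σ-inj : Injective _≡_ _≡_ σ
    σ-inj {i} {j} eq with π-inj (punchOut-injective (a≢π∘suc i) (a≢π∘suc j) eq)
    ... | refl = refl
    w : Vec A n
    w = tabulate (lookup v ∘ punchIn a)
    lookup-w∘σ : ∀ i → lookup w (σ i) ≡ lookup v (π (suc i))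
    lookup-w∘σ i = trans (lookup∘tabulate _ (σ i)) (cong (lookup v) (punchIn-punchOut (a≢π∘suc i)))

insertSorted-↭ : ∀ {k} (v : Vec ℤ k) (ws : Vec (Vec ℤ k) c) → v ∷ ws ↭ insertSorted v ws
insertSorted-↭ v [] = ↭-refl
insertSorted-↭ v (w ∷ ws) with leqᵥᵇ v w
... | true = ↭-refl
... | false = ↭-trans (↭-swap v w ws) (↭-prep w (insertSorted-↭ v ws))

sortVecs-↭ : ∀ {k} (vs : Vec (Vec ℤ k) c) → vs ↭ sortVecs vs
sortVecs-↭ [] = ↭-refl
sortVecs-↭ (v ∷ vs) = ↭-trans (↭-prep v (sortVecs-↭ vs)) (insertSorted-↭ v (sortVecs vs))

sortVecs-cong : ∀ {k} {us vs : Vec (Vec ℤ k) c} → us ↭ vs → sortVecs us ≡ sortVecs vs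
sortVecs-cong ↭-refl = refl
sortVecs-cong (↭-prep v p) = cong (insertSorted v) (sortVecs-cong p)
sortVecs-cong (↭-swap u v vs) = insertSorted-comm u v (sortVecs vs)
sortVecs-cong (↭-trans p q) = trans (sortVecs-cong p) (sortVecs-cong q)

vec-ext : {A : Set} {u v : Vec A k} → (∀ i → lookup u i ≡ lookup v i) → u ≡ v
vec-ext eq = Pointwise-≡⇒≡ (ext eq)

matrix-ext : {A B : Matrix m n} → (∀ i j → entry A i j ≡ entry B i j) → A ≡ B
matrix-ext eq = vec-ext λ i → vec-ext (eq i)

entry-mk : (f : Fin m → Fin n → ℤ) (i : Fin m) (j : Fin n) → entry (mk f) i j ≡ f i j
entry-mk f i j = trans (cong (λ r → lookup r j) (lookup∘tabulate _ i)) (lookup∘tabulate (f i) j)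

transpose-∷ : (r : Vec ℤ n) (M : Matrix m n) → transpose (r ∷ M) ≡ zipWith _∷_ r (transpose M)
transpose-∷ r M = sym (zipWith-is-⊛ _∷_ r (transpose M))

lookup-transpose : (M : Matrix m n) (j : Fin n) → lookup (transpose M) j ≡ col M j
lookup-transpose [] j = lookup-replicate j []
lookup-transpose (r ∷ M) j = begin
  lookup (transpose (r ∷ M)) j           ≡⟨ cong (λ T → lookup T j) (transpose-∷ r M) ⟩
  lookup (zipWith _∷_ r (transpose M)) j ≡⟨ lookup-zipWith _∷_ j r (transpose M) ⟩
  lookup r j ∷ lookup (transpose M) j    ≡⟨ cong (lookup r j ∷_) (lookup-transpose M j) ⟩
  col (r ∷ M) j                          ∎
  where open ≡-Reasoning

entry-transpose : (M : Matrix m n) (j : Fin n) (i : Fin m) → entry (transpose M) j i ≡ entry M i j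
entry-transpose M j i =
  trans (cong (λ c → lookup c i) (lookup-transpose M j)) (lookup-map i (λ r → lookup r j) M)

transpose-involutive : (M : Matrix m n) → transpose (transpose M) ≡ M
transpose-involutive M =
  matrix-ext λ i j → trans (entry-transpose (transpose M) i j) (entry-transpose M j i)

mk-entry : (M : Matrix m n) → mk (entry M) ≡ M
mk-entry M = matrix-ext (entry-mk (entry M))

negateIf : Bool → ℤ → ℤ
negateIf b x = if b then - x else x

entry-negRow : (i₀ : Fin m) (M : Matrix m n) (i : Fin m) (j : Fin n) →
               entry (negRow i₀ M) i j ≡ negateIf (isYes (i ≟ i₀)) (entry M i j)
entry-negRow i₀ M = entry-mk _

entry-swapRows : (a b : Fin m) (M : Matrix m n) (i : Fin m) (j : Fin n) →
                 entry (swapRows a b M) i j ≡ entry M (swapIdx a b i) j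
entry-swapRows a b M = entry-mk _

entry-negCol : (j₀ : Fin n) (M : Matrix m n) (i : Fin m) (j : Fin n) →
               entry (negCol j₀ M) i j ≡ negateIf (isYes (j ≟ j₀)) (entry M i j)
entry-negCol j₀ M = entry-mk _

entry-swapCols : (a b : Fin n) (M : Matrix m n) (i : Fin m) (j : Fin n) →
                 entry (swapCols a b M) i j ≡ entry M i (swapIdx a b j)
entry-swapCols a b M = entry-mk _

isYes-suc≟suc : (i j : Fin k) → isYes (suc i ≟ suc j) ≡ isYes (i ≟ j)
isYes-suc≟suc i j with i ≟ j
... | yes _ = refl
... | no _ = refl

swapIdx-suc : (a b i : Fin k) → swapIdx (suc a) (suc b) (suc i) ≡ suc (swapIdx a b i)
swapIdx-suc a b i with i ≟ a | i ≟ b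
... | yes _ | _ = refl
... | no _ | yes _ = refl
... | no _ | no _ = refl

-- Unlike column operations, row operations commute with putting a fixed row on top (RowEquiv-∷).
data RowStep {m n : ℕ} : Matrix m n → Matrix m n → Set where
  negR  : ∀ M i → RowStep M (negRow i M)
  swapR : ∀ M a b → RowStep M (swapRows a b M)

RowEquiv : Matrix m n → Matrix m n → Set
RowEquiv = Star RowStep

RowEquiv⇒HadEquiv : {M N : Matrix m n} → RowEquiv M N → HadEquiv M N
RowEquiv⇒HadEquiv = gmap id λ { (negR M i) → negR M i ; (swapR M a b) → swapR M a b }

transpose-negRow : (i : Fin m) (M : Matrix m n) → transpose (negRow i M) ≡ negCol i (transpose M)
transpose-negRow i M = matrix-ext λ j k → begin
  entry (transpose (negRow i M)) j k           ≡⟨ entry-transpose (negRow i M) j k ⟩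
  entry (negRow i M) k j                       ≡⟨ entry-negRow i M k j ⟩
  negateIf (isYes (k ≟ i)) (entry M k j)             ≡⟨ cong (negateIf _) (entry-transpose M j k) ⟨
  negateIf (isYes (k ≟ i)) (entry (transpose M) j k) ≡⟨ entry-negCol i (transpose M) j k ⟨
  entry (negCol i (transpose M)) j k           ∎
  where open ≡-Reasoning

transpose-swapRows : (a b : Fin m) (M : Matrix m n) →
                     transpose (swapRows a b M) ≡ swapCols a b (transpose M)
transpose-swapRows a b M = matrix-ext λ j k → begin
  entry (transpose (swapRows a b M)) j k    ≡⟨ entry-transpose (swapRows a b M) j k ⟩
  entry (swapRows a b M) k j                ≡⟨ entry-swapRows a b M k j ⟩
  entry M (swapIdx a b k) j                 ≡⟨ entry-transpose M j (swapIdx a b k) ⟨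
  entry (transpose M) j (swapIdx a b k)     ≡⟨ entry-swapCols a b (transpose M) j k ⟨
  entry (swapCols a b (transpose M)) j k    ∎
  where open ≡-Reasoning

RowEquiv⇒HadEquiv-transpose : {M N : Matrix m n} → RowEquiv M N → HadEquiv (transpose M) (transpose N)
RowEquiv⇒HadEquiv-transpose = gmap transpose λ
  { (negR M i) → subst (HadStep (transpose M)) (sym (transpose-negRow i M)) (negC (transpose M) i)
  ; (swapR M a b) → subst (HadStep (transpose M)) (sym (transpose-swapRows a b M)) (swapC (transpose M) a b)
  }

negRow-suc : (i : Fin m) (r : Vec ℤ n) (M : Matrix m n) → negRow (suc i) (r ∷ M) ≡ r ∷ negRow i M
negRow-suc i r M = matrix-ext λ
  { zero j → entry-negRow (suc i) (r ∷ M) zero j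
  ; (suc k) j → begin
      entry (negRow (suc i) (r ∷ M)) (suc k) j
        ≡⟨ entry-negRow (suc i) (r ∷ M) (suc k) j ⟩
      negateIf (isYes (suc k ≟ suc i)) (entry M k j)
        ≡⟨ cong (λ b → negateIf b (entry M k j)) (isYes-suc≟suc k i) ⟩
      negateIf (isYes (k ≟ i)) (entry M k j)
        ≡⟨ entry-negRow i M k j ⟨
      entry (negRow i M) k j ∎ }
  where open ≡-Reasoning

swapRows-suc : (a b : Fin m) (r : Vec ℤ n) (M : Matrix m n) →
               swapRows (suc a) (suc b) (r ∷ M) ≡ r ∷ swapRows a b M
swapRows-suc a b r M = matrix-ext λ
  { zero j → entry-swapRows (suc a) (suc b) (r ∷ M) zero j
  ; (suc k) j → begin
      entry (swapRows (suc a) (suc b) (r ∷ M)) (suc k) j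
        ≡⟨ entry-swapRows (suc a) (suc b) (r ∷ M) (suc k) j ⟩
      entry (r ∷ M) (swapIdx (suc a) (suc b) (suc k)) j
        ≡⟨ cong (λ i → entry (r ∷ M) i j) (swapIdx-suc a b k) ⟩
      entry M (swapIdx a b k) j
        ≡⟨ entry-swapRows a b M k j ⟨
      entry (swapRows a b M) k j ∎ }
  where open ≡-Reasoning

RowEquiv-∷ : (r : Vec ℤ n) {M N : Matrix m n} → RowEquiv M N → RowEquiv (r ∷ M) (r ∷ N)
RowEquiv-∷ r = gmap (r ∷_) λ
  { (negR M i) → subst (RowStep (r ∷ M)) (negRow-suc i r M) (negR (r ∷ M) (suc i))
  ; (swapR M a b) → subst (RowStep (r ∷ M)) (swapRows-suc a b r M) (swapR (r ∷ M) (suc a) (suc b))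
  }

swapRows-head : (x y : Vec ℤ n) (M : Matrix m n) →
                swapRows zero (suc zero) (x ∷ y ∷ M) ≡ y ∷ x ∷ M
swapRows-head x y M = matrix-ext λ
  { zero j → entry-swapRows zero (suc zero) (x ∷ y ∷ M) zero j
  ; (suc zero) j → entry-swapRows zero (suc zero) (x ∷ y ∷ M) (suc zero) j
  ; (suc (suc i)) j → entry-swapRows zero (suc zero) (x ∷ y ∷ M) (suc (suc i)) j
  }

↭⇒RowEquiv : {M N : Matrix m n} → M ↭ N → RowEquiv M N
↭⇒RowEquiv ↭-refl = ε
↭⇒RowEquiv (↭-prep r p) = RowEquiv-∷ r (↭⇒RowEquiv p)
↭⇒RowEquiv (↭-swap x y M) =
  subst (RowStep _) (swapRows-head x y M) (swapR (x ∷ y ∷ M) zero (suc zero)) ◅ ε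
↭⇒RowEquiv (↭-trans p q) = ↭⇒RowEquiv p ◅◅ ↭⇒RowEquiv q

negateRows : (Fin m → Bool) → Matrix m n → Matrix m n
negateRows s M = mk λ i j → negateIf (s i) (entry M i j)

negateRows-RowEquiv : (s : Fin m → Bool) (M : Matrix m n) → RowEquiv M (negateRows s M)
negateRows-RowEquiv s [] = ε
negateRows-RowEquiv s (r ∷ M) =
  negateHead (s zero) ◅◅ RowEquiv-∷ _ (negateRows-RowEquiv (s ∘ suc) M)
  where
  negateHead : (b : Bool) → RowEquiv (r ∷ M) (tabulate (λ j → negateIf b (lookup r j)) ∷ M)
  negateHead true = subst (RowStep (r ∷ M)) (cong (_ ∷_) (mk-entry M)) (negR (r ∷ M) zero) ◅ ε
  negateHead false = subst (λ r′ → RowEquiv (r ∷ M) (r′ ∷ M)) (sym (tabulate∘lookup r)) ε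

negateCols : (Fin n → Bool) → Matrix m n → Matrix m n
negateCols t M = mk λ i j → negateIf (t j) (entry M i j)

transpose-negateRows : (t : Fin n → Bool) (M : Matrix m n) →
                       transpose (negateRows t (transpose M)) ≡ negateCols t M
transpose-negateRows t M = matrix-ext λ i j → begin
  entry (transpose (negateRows t (transpose M))) i j
    ≡⟨ entry-transpose (negateRows t (transpose M)) i j ⟩
  entry (negateRows t (transpose M)) j i
    ≡⟨ entry-mk _ j i ⟩
  negateIf (t j) (entry (transpose M) j i)
    ≡⟨ cong (negateIf (t j)) (entry-transpose M j i) ⟩
  negateIf (t j) (entry M i j)
    ≡⟨ entry-mk _ i j ⟨
  entry (negateCols t M) i j ∎
  where open ≡-Reasoning

RowEquiv-transpose⇒HadEquiv : {M : Matrix m n} {N : Matrix n m} →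
                              RowEquiv (transpose M) N → HadEquiv M (transpose N)
RowEquiv-transpose⇒HadEquiv {M = M} Mᵀ≈N =
  subst (λ X → HadEquiv X _) (transpose-involutive M) (RowEquiv⇒HadEquiv-transpose Mᵀ≈N)

HadEquiv-negateCols : (t : Fin n → Bool) (M : Matrix m n) → HadEquiv M (negateCols t M)
HadEquiv-negateCols t M =
  subst (HadEquiv M) (transpose-negateRows t M)
        (RowEquiv-transpose⇒HadEquiv (negateRows-RowEquiv t (transpose M)))

HadEquiv-Ord : (M : Matrix m n) → HadEquiv M (Ord M)
HadEquiv-Ord M = RowEquiv-transpose⇒HadEquiv (↭⇒RowEquiv (sortVecs-↭ (transpose M)))

canon : Matrix m n → Matrix m n
canon M = Ord (Neg M)

HadEquiv-canon : (M : Matrix m n) → HadEquiv M (canon M)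
HadEquiv-canon M = HadEquiv-negateCols _ M ◅◅ HadEquiv-Ord (Neg M)

-- Neg and Ord lower a matrix

negateEntries : (Fin k → Bool) → Vec ℤ k → Vec ℤ k
negateEntries t r = tabulate λ j → negateIf (t j) (lookup r j)

negateIf-≤ : (b : Bool) (x : ℤ) (c : Vec ℤ m) → (T b → T (beginsPositive (x ∷ c))) →
             negateIf b x ℤ.< x ⊎ (negateIf b x ≡ x × (T b → T (beginsPositive c)))
negateIf-≤ false x c _ = inj₂ (refl , λ ())
negateIf-≤ true (+ zero) c pos = inj₂ (refl , pos)
negateIf-≤ true (+ suc n) c pos = inj₁ ℤ.-<+
negateIf-≤ true -[1+ n ] c pos = ⊥-elim (pos _)

negateEntries-≤ᵥ : (t : Fin k → Bool) (r : Vec ℤ k) (cs : Fin k → Vec ℤ m) →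
                   (∀ j → T (t j) → T (beginsPositive (lookup r j ∷ cs j))) →
                   negateEntries t r <ᵥ r
                     ⊎ (negateEntries t r ≡ r × (∀ j → T (t j) → T (beginsPositive (cs j))))
negateEntries-≤ᵥ t [] cs pos = inj₂ (refl , λ ())
negateEntries-≤ᵥ t (x ∷ r) cs pos with negateIf-≤ (t zero) x (cs zero) (pos zero)
... | inj₁ x′<x = inj₁ (inj₁ x′<x)
... | inj₂ (x′≡x , pos₀) with negateEntries-≤ᵥ (t ∘ suc) r (cs ∘ suc) (pos ∘ suc)
...   | inj₁ r′<r = inj₁ (inj₂ (x′≡x , r′<r))
...   | inj₂ (r′≡r , pos₊) =
  inj₂ (cong₂ _∷_ x′≡x r′≡r , λ { zero → pos₀ ; (suc j) → pos₊ j })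

negateCols-≤R : (t : Fin n → Bool) (M : Matrix m n) →
                (∀ j → T (t j) → T (beginsPositive (col M j))) →
                negateCols t M ≤R M
negateCols-≤R t [] pos = inj₂ refl
negateCols-≤R t (r ∷ M) pos with negateEntries-≤ᵥ t r (col M) pos
... | inj₁ r′<r = inj₁ (inj₁ r′<r)
... | inj₂ (r′≡r , pos₊) with negateCols-≤R t M pos₊
...   | inj₁ M′<M = inj₁ (inj₂ (r′≡r , M′<M))
...   | inj₂ M′≡M = inj₂ (cong₂ _∷_ r′≡r M′≡M)

Neg-≤R : (M : Matrix m n) → Neg M ≤R M
Neg-≤R M = negateCols-≤R (λ j → beginsPositive (col M j)) M λ j pos → pos

zipWith-∷-<R : (v : Vec ℤ m) {A B : Matrix m n} → A <R B → zipWith _∷_ v A <R zipWith _∷_ v B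
zipWith-∷-<R [] {[]} {[]} ()
zipWith-∷-<R (x ∷ v) {_ ∷ _} {_ ∷ _} (inj₁ a<b) = inj₁ (inj₂ (refl , a<b))
zipWith-∷-<R (x ∷ v) {_ ∷ _} {_ ∷ _} (inj₂ (refl , A<B)) = inj₂ (refl , zipWith-∷-<R v A<B)

zipWith-∷-≤R : (v : Vec ℤ m) {A B : Matrix m n} → A ≤R B → zipWith _∷_ v A ≤R zipWith _∷_ v B
zipWith-∷-≤R v (inj₁ A<B) = inj₁ (zipWith-∷-<R v A<B)
zipWith-∷-≤R v (inj₂ refl) = inj₂ refl

zipWith-swap-<R : {u v : Vec ℤ m} → u <ᵥ v → (A : Matrix m n) →
                  zipWith _∷_ u (zipWith _∷_ v A) <R zipWith _∷_ v (zipWith _∷_ u A)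
zipWith-swap-<R {u = []} {[]} () []
zipWith-swap-<R {u = _ ∷ _} {_ ∷ _} (inj₁ x<y) (_ ∷ _) = inj₁ (inj₁ x<y)
zipWith-swap-<R {u = _ ∷ _} {_ ∷ _} (inj₂ (refl , u<v)) (_ ∷ A) =
  inj₂ (refl , zipWith-swap-<R u<v A)

≰ᵥ⇒>ᵥ : {u v : Vec ℤ k} → ¬ u ≤ᵥ v → v <ᵥ u
≰ᵥ⇒>ᵥ {u = u} {v} u≰v with IsStrictTotalOrder.compare <ᵥ-isStrictTotalOrder u v
... | tri< u<v _ _ = ⊥-elim (u≰v (inj₁ u<v))
... | tri≈ _ u≡v _ = ⊥-elim (u≰v (inj₂ u≡v))
... | tri> _ _ v<u = v<u

insertSorted-≤R : (v : Vec ℤ m) (ws : Vec (Vec ℤ m) c) →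
                  transpose (insertSorted v ws) ≤R transpose (v ∷ ws)
insertSorted-≤R v [] = inj₂ refl
insertSorted-≤R v (w ∷ ws) with leqᵥᵇ v w | leqᵥᵇ-reflects v w
... | true | _ = inj₂ refl
... | false | ofⁿ v≰w = begin
  transpose (w ∷ insertSorted v ws)
    ≡⟨ transpose-∷ w (insertSorted v ws) ⟩
  zipWith _∷_ w (transpose (insertSorted v ws))
    ≤⟨ zipWith-∷-≤R w (insertSorted-≤R v ws) ⟩
  zipWith _∷_ w (transpose (v ∷ ws))
    ≡⟨ cong (zipWith _∷_ w) (transpose-∷ v ws) ⟩
  zipWith _∷_ w (zipWith _∷_ v (transpose ws))
    ≤⟨ inj₁ (zipWith-swap-<R (≰ᵥ⇒>ᵥ v≰w) (transpose ws)) ⟩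
  zipWith _∷_ v (zipWith _∷_ w (transpose ws))
    ≡⟨ cong (zipWith _∷_ v) (transpose-∷ w ws) ⟨
  zipWith _∷_ v (transpose (w ∷ ws))
    ≡⟨ transpose-∷ v (w ∷ ws) ⟨
  transpose (v ∷ w ∷ ws) ∎
  where open ≤R-Reasoning

sortVecs-≤R : (vs : Vec (Vec ℤ m) c) → transpose (sortVecs vs) ≤R transpose vs
sortVecs-≤R [] = inj₂ refl
sortVecs-≤R (v ∷ vs) = begin
  transpose (insertSorted v (sortVecs vs))   ≤⟨ insertSorted-≤R v (sortVecs vs) ⟩
  transpose (v ∷ sortVecs vs)                ≡⟨ transpose-∷ v (sortVecs vs) ⟩
  zipWith _∷_ v (transpose (sortVecs vs))    ≤⟨ zipWith-∷-≤R v (sortVecs-≤R vs) ⟩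
  zipWith _∷_ v (transpose vs)               ≡⟨ transpose-∷ v vs ⟨
  transpose (v ∷ vs)                         ∎
  where open ≤R-Reasoning

Ord-≤R : (M : Matrix m n) → Ord M ≤R M
Ord-≤R M = subst (Ord M ≤R_) (transpose-involutive M) (sortVecs-≤R (transpose M))

canon-≤R : (M : Matrix m n) → canon M ≤R M
canon-≤R M = begin
  Ord (Neg M) ≤⟨ Ord-≤R (Neg M) ⟩
  Neg M       ≤⟨ Neg-≤R M ⟩
  M           ∎
  where open ≤R-Reasoning

-- The Hadamard class as signed permutations of rows and columns

negateIf-xor : (a b : Bool) (x : ℤ) → negateIf a (negateIf b x) ≡ negateIf (a xor b) x
negateIf-xor true true x = ℤ.neg-involutive x
negateIf-xor true false x = refl
negateIf-xor false b x = refl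

negateIf-comm : (a b : Bool) (x : ℤ) → negateIf a (negateIf b x) ≡ negateIf b (negateIf a x)
negateIf-comm true true x = refl
negateIf-comm true false x = refl
negateIf-comm false b x = refl

swapIdx-transpose : (a b i : Fin k) → swapIdx a b i ≡ Perm.transpose a b ⟨$⟩ʳ i
swapIdx-transpose a b i with i ≟ a
... | yes _ = refl
... | no _ with i ≟ b
...   | yes _ = refl
...   | no _ = refl

⟨$⟩ʳ-injective : (ρ : Permutation′ n) → Injective _≡_ _≡_ (ρ ⟨$⟩ʳ_)
⟨$⟩ʳ-injective ρ = Injection.injective (↔⇒↣ ρ)

flipAt : Fin k → (Fin k → Bool) → Fin k → Bool
flipAt a s i = isYes (i ≟ a) xor s i

-- rearrange ρ s κ t M = P M Q for the signed permutation matrices P of (ρ, s) and Q of (κ, t).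
rearrange : Permutation′ m → (Fin m → Bool) → Permutation′ n → (Fin n → Bool) →
            Matrix m n → Matrix m n
rearrange ρ s κ t M = mk λ i j →
  negateIf (s i) (negateIf (t j) (entry M (ρ ⟨$⟩ʳ i) (κ ⟨$⟩ʳ j)))

rearrangeRows : Permutation′ m → (Fin m → Bool) → Matrix m n → Matrix m n
rearrangeRows ρ s = rearrange ρ s Perm.id (λ _ → false)

Rearranged : Matrix m n → Matrix m n → Set
Rearranged {m} {n} M X =
  ∃₂ λ (ρ : Permutation′ m) (s : Fin m → Bool) →
  ∃₂ λ (κ : Permutation′ n) (t : Fin n → Bool) → X ≡ rearrange ρ s κ t M

module _ (ρ : Permutation′ m) (s : Fin m → Bool) (κ : Permutation′ n) (t : Fin n → Bool)
         (M : Matrix m n) where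

  private
    R : Matrix m n
    R = rearrange ρ s κ t M
    x : Fin m → Fin n → ℤ
    x i j = entry M (ρ ⟨$⟩ʳ i) (κ ⟨$⟩ʳ j)

  negRow-rearrange : (a : Fin m) → negRow a R ≡ rearrange ρ (flipAt a s) κ t M
  negRow-rearrange a = matrix-ext λ i j → begin
    entry (negRow a R) i j
      ≡⟨ entry-negRow a R i j ⟩
    negateIf (isYes (i ≟ a)) (entry R i j)
      ≡⟨ cong (negateIf _) (entry-mk _ i j) ⟩
    negateIf (isYes (i ≟ a)) (negateIf (s i) (negateIf (t j) (x i j)))
      ≡⟨ negateIf-xor (isYes (i ≟ a)) (s i) _ ⟩
    negateIf (flipAt a s i) (negateIf (t j) (x i j))
      ≡⟨ entry-mk _ i j ⟨
    entry (rearrange ρ (flipAt a s) κ t M) i j ∎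
    where open ≡-Reasoning

  negCol-rearrange : (a : Fin n) → negCol a R ≡ rearrange ρ s κ (flipAt a t) M
  negCol-rearrange a = matrix-ext λ i j → begin
    entry (negCol a R) i j
      ≡⟨ entry-negCol a R i j ⟩
    negateIf (isYes (j ≟ a)) (entry R i j)
      ≡⟨ cong (negateIf _) (entry-mk _ i j) ⟩
    negateIf (isYes (j ≟ a)) (negateIf (s i) (negateIf (t j) (x i j)))
      ≡⟨ negateIf-comm (isYes (j ≟ a)) (s i) _ ⟩
    negateIf (s i) (negateIf (isYes (j ≟ a)) (negateIf (t j) (x i j)))
      ≡⟨ cong (negateIf (s i)) (negateIf-xor (isYes (j ≟ a)) (t j) _) ⟩
    negateIf (s i) (negateIf (flipAt a t j) (x i j))
      ≡⟨ entry-mk _ i j ⟨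
    entry (rearrange ρ s κ (flipAt a t) M) i j ∎
    where open ≡-Reasoning

  swapRows-rearrange : (a b : Fin m) →
                       swapRows a b R ≡ rearrange (Perm.transpose a b ∘ₚ ρ) (s ∘ swapIdx a b) κ t M
  swapRows-rearrange a b = matrix-ext λ i j → begin
    entry (swapRows a b R) i j
      ≡⟨ entry-swapRows a b R i j ⟩
    entry R (swapIdx a b i) j
      ≡⟨ entry-mk _ (swapIdx a b i) j ⟩
    negateIf (s (swapIdx a b i)) (negateIf (t j) (x (swapIdx a b i) j))
      ≡⟨ cong (λ k → negateIf (s (swapIdx a b i)) (negateIf (t j) (x k j))) (swapIdx-transpose a b i) ⟩
    negateIf (s (swapIdx a b i)) (negateIf (t j) (x (Perm.transpose a b ⟨$⟩ʳ i) j))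
      ≡⟨ entry-mk _ i j ⟨
    entry (rearrange (Perm.transpose a b ∘ₚ ρ) (s ∘ swapIdx a b) κ t M) i j ∎
    where open ≡-Reasoning

  swapCols-rearrange : (a b : Fin n) →
                       swapCols a b R ≡ rearrange ρ s (Perm.transpose a b ∘ₚ κ) (t ∘ swapIdx a b) M
  swapCols-rearrange a b = matrix-ext λ i j → begin
    entry (swapCols a b R) i j
      ≡⟨ entry-swapCols a b R i j ⟩
    entry R i (swapIdx a b j)
      ≡⟨ entry-mk _ i (swapIdx a b j) ⟩
    negateIf (s i) (negateIf (t (swapIdx a b j)) (x i (swapIdx a b j)))
      ≡⟨ cong (λ k → negateIf (s i) (negateIf (t (swapIdx a b j)) (x i k))) (swapIdx-transpose a b j) ⟩
    negateIf (s i) (negateIf (t (swapIdx a b j)) (x i (Perm.transpose a b ⟨$⟩ʳ j)))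
      ≡⟨ entry-mk _ i j ⟨
    entry (rearrange ρ s (Perm.transpose a b ∘ₚ κ) (t ∘ swapIdx a b) M) i j ∎
    where open ≡-Reasoning

Rearranged-step : {M X Y : Matrix m n} → HadStep X Y → Rearranged M X → Rearranged M Y
Rearranged-step {M = M} (negR _ a) (ρ , s , κ , t , refl) =
  ρ , flipAt a s , κ , t , negRow-rearrange ρ s κ t M a
Rearranged-step {M = M} (negC _ a) (ρ , s , κ , t , refl) =
  ρ , s , κ , flipAt a t , negCol-rearrange ρ s κ t M a
Rearranged-step {M = M} (swapR _ a b) (ρ , s , κ , t , refl) =
  Perm.transpose a b ∘ₚ ρ , s ∘ swapIdx a b , κ , t , swapRows-rearrange ρ s κ t M a b
Rearranged-step {M = M} (swapC _ a b) (ρ , s , κ , t , refl) =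
  ρ , s , Perm.transpose a b ∘ₚ κ , t ∘ swapIdx a b , swapCols-rearrange ρ s κ t M a b

HadEquiv⇒Rearranged : {M X : Matrix m n} → HadEquiv M X → Rearranged M X
HadEquiv⇒Rearranged {M = M} =
  go (Perm.id , (λ _ → false) , Perm.id , (λ _ → false) , sym (mk-entry M))
  where
  go : ∀ {X Y} → Rearranged M X → HadEquiv X Y → Rearranged M Y
  go r ε = r
  go r (step ◅ steps) = go (Rearranged-step {M = M} step r) steps

HadEquiv-rearrangeRows : (ρ : Permutation′ m) (s : Fin m → Bool) (M : Matrix m n) →
                         HadEquiv M (rearrangeRows ρ s M)
HadEquiv-rearrangeRows ρ s M = RowEquiv⇒HadEquiv
  (↭⇒RowEquiv (↭-tabulate M (⟨$⟩ʳ-injective ρ)) ◅◅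
   subst (RowEquiv _) negate-permuted (negateRows-RowEquiv s _))
  where
  negate-permuted : negateRows s (tabulate (lookup M ∘ (ρ ⟨$⟩ʳ_))) ≡ rearrangeRows ρ s M
  negate-permuted = matrix-ext λ i j → begin
    entry (negateRows s (tabulate (lookup M ∘ (ρ ⟨$⟩ʳ_)))) i j
      ≡⟨ entry-mk _ i j ⟩
    negateIf (s i) (lookup (lookup (tabulate (lookup M ∘ (ρ ⟨$⟩ʳ_))) i) j)
      ≡⟨ cong (λ r → negateIf (s i) (lookup r j)) (lookup∘tabulate _ i) ⟩
    negateIf (s i) (entry M (ρ ⟨$⟩ʳ i) j)
      ≡⟨ entry-mk _ i j ⟨
    entry (rearrangeRows ρ s M) i j ∎
    where open ≡-Reasoning

nrm : Vec ℤ k → Vec ℤ k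
nrm [] = []
nrm (+ zero ∷ v) = + zero ∷ nrm v
nrm (+ suc n ∷ v) = map -_ (+ suc n ∷ v)
nrm (-[1+ n ] ∷ v) = -[1+ n ] ∷ v

negateIf-0 : (b : Bool) → negateIf b (+ 0) ≡ + 0
negateIf-0 true = refl
negateIf-0 false = refl

lookup-nrm : (v : Vec ℤ k) (i : Fin k) → lookup (nrm v) i ≡ negateIf (beginsPositive v) (lookup v i)
lookup-nrm (+ zero ∷ v) zero = sym (negateIf-0 (beginsPositive v))
lookup-nrm (+ zero ∷ v) (suc i) = lookup-nrm v i
lookup-nrm (+ suc n ∷ v) i = lookup-map i -_ (+ suc n ∷ v)
lookup-nrm (-[1+ n ] ∷ v) i = refl

nrm-neg : (v : Vec ℤ k) → nrm (map -_ v) ≡ nrm v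
nrm-neg [] = refl
nrm-neg (+ zero ∷ v) = cong (+ zero ∷_) (nrm-neg v)
nrm-neg (+ suc n ∷ v) = refl
nrm-neg (-[1+ n ] ∷ v) =
  cong (-[1+ n ] ∷_) (trans (sym (map-∘ -_ -_ v)) (trans (map-cong ℤ.neg-involutive v) (map-id v)))

nrm-negateIf : (b : Bool) (v : Vec ℤ k) → nrm (map (negateIf b) v) ≡ nrm v
nrm-negateIf true v = nrm-neg v
nrm-negateIf false v = cong nrm (map-id v)

transpose-Neg : (M : Matrix m n) → transpose (Neg M) ≡ map nrm (transpose M)
transpose-Neg M = matrix-ext λ j i → begin
  entry (transpose (Neg M)) j i
    ≡⟨ entry-transpose (Neg M) j i ⟩
  entry (Neg M) i j
    ≡⟨ entry-mk _ i j ⟩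
  negateIf (beginsPositive (col M j)) (entry M i j)
    ≡⟨ cong (negateIf _) (lookup-map i (λ r → lookup r j) M) ⟨
  negateIf (beginsPositive (col M j)) (lookup (col M j) i)
    ≡⟨ lookup-nrm (col M j) i ⟨
  lookup (nrm (col M j)) i
    ≡⟨ cong (λ c → lookup (nrm c) i) (lookup-transpose M j) ⟨
  lookup (nrm (lookup (transpose M) j)) i
    ≡⟨ cong (λ c → lookup c i) (lookup-map j nrm (transpose M)) ⟨
  entry (map nrm (transpose M)) j i ∎
  where open ≡-Reasoning

canon-sortVecs : (M : Matrix m n) → canon M ≡ transpose (sortVecs (map nrm (transpose M)))
canon-sortVecs M = cong (transpose ∘ sortVecs) (transpose-Neg M)

module _ (ρ : Permutation′ m) (s : Fin m → Bool) (κ : Permutation′ n) (t : Fin n → Bool)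
         (M : Matrix m n) where

  private
    R R₀ : Matrix m n
    R = rearrange ρ s κ t M
    R₀ = rearrangeRows ρ s M

  col-rearrange : (j : Fin n) → col R j ≡ map (negateIf (t j)) (col R₀ (κ ⟨$⟩ʳ j))
  col-rearrange j = vec-ext λ i → begin
    lookup (col R j) i
      ≡⟨ lookup-map i (λ r → lookup r j) R ⟩
    entry R i j
      ≡⟨ entry-mk _ i j ⟩
    negateIf (s i) (negateIf (t j) (entry M (ρ ⟨$⟩ʳ i) (κ ⟨$⟩ʳ j)))
      ≡⟨ negateIf-comm (s i) (t j) _ ⟩
    negateIf (t j) (negateIf (s i) (entry M (ρ ⟨$⟩ʳ i) (κ ⟨$⟩ʳ j)))
      ≡⟨ cong (negateIf (t j)) (entry-mk _ i (κ ⟨$⟩ʳ j)) ⟨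
    negateIf (t j) (entry R₀ i (κ ⟨$⟩ʳ j))
      ≡⟨ cong (negateIf (t j)) (lookup-map i (λ r → lookup r (κ ⟨$⟩ʳ j)) R₀) ⟨
    negateIf (t j) (lookup (col R₀ (κ ⟨$⟩ʳ j)) i)
      ≡⟨ lookup-map i (negateIf (t j)) (col R₀ (κ ⟨$⟩ʳ j)) ⟨
    lookup (map (negateIf (t j)) (col R₀ (κ ⟨$⟩ʳ j))) i ∎
    where open ≡-Reasoning

  nrm-columns-rearrange :
    map nrm (transpose R) ≡ tabulate (lookup (map nrm (transpose R₀)) ∘ (κ ⟨$⟩ʳ_))
  nrm-columns-rearrange = vec-ext λ j → begin
    lookup (map nrm (transpose R)) j
      ≡⟨ lookup-map j nrm (transpose R) ⟩
    nrm (lookup (transpose R) j)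
      ≡⟨ cong nrm (trans (lookup-transpose R j) (col-rearrange j)) ⟩
    nrm (map (negateIf (t j)) (col R₀ (κ ⟨$⟩ʳ j)))
      ≡⟨ nrm-negateIf (t j) (col R₀ (κ ⟨$⟩ʳ j)) ⟩
    nrm (col R₀ (κ ⟨$⟩ʳ j))
      ≡⟨ cong nrm (lookup-transpose R₀ (κ ⟨$⟩ʳ j)) ⟨
    nrm (lookup (transpose R₀) (κ ⟨$⟩ʳ j))
      ≡⟨ lookup-map (κ ⟨$⟩ʳ j) nrm (transpose R₀) ⟨
    lookup (map nrm (transpose R₀)) (κ ⟨$⟩ʳ j)
      ≡⟨ lookup∘tabulate _ j ⟨
    lookup (tabulate (lookup (map nrm (transpose R₀)) ∘ (κ ⟨$⟩ʳ_))) j ∎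
    where open ≡-Reasoning

  -- Negating a column does not change its nrm, and permuting columns does not change their sorted list.
  canon-rearrange : canon R ≡ canon R₀
  canon-rearrange = begin
    canon R
      ≡⟨ canon-sortVecs R ⟩
    transpose (sortVecs (map nrm (transpose R)))
      ≡⟨ cong (transpose ∘ sortVecs) nrm-columns-rearrange ⟩
    transpose (sortVecs (tabulate (lookup (map nrm (transpose R₀)) ∘ (κ ⟨$⟩ʳ_))))
      ≡⟨ cong transpose (sortVecs-cong (↭-tabulate (map nrm (transpose R₀)) (⟨$⟩ʳ-injective κ))) ⟨
    transpose (sortVecs (map nrm (transpose R₀)))
      ≡⟨ canon-sortVecs R₀ ⟨
    canon R₀ ∎
    where open ≡-Reasoning

-- Monomial matrices

sumℤ-zero : (f : Fin k → ℤ) → (∀ l → f l ≡ 0ℤ) → sumℤ (tabulate f) ≡ 0ℤ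
sumℤ-zero {zero} f f≡0 = refl
sumℤ-zero {suc k} f f≡0 = cong₂ _+_ (f≡0 zero) (sumℤ-zero (f ∘ suc) (f≡0 ∘ suc))

sumℤ-single : (f : Fin k → ℤ) (l₀ : Fin k) → (∀ l → l ≢ l₀ → f l ≡ 0ℤ) →
              sumℤ (tabulate f) ≡ f l₀
sumℤ-single f zero f≡0 = trans
  (cong₂ _+_ (refl {x = f zero}) (sumℤ-zero (f ∘ suc) λ l → f≡0 (suc l) λ ()))
  (ℤ.+-identityʳ (f zero))
sumℤ-single f (suc l₀) f≡0 = trans
  (cong₂ _+_ (f≡0 zero λ ()) (sumℤ-single (f ∘ suc) l₀ λ l l≢l₀ → f≡0 (suc l) (l≢l₀ ∘ suc-injective)))
  (ℤ.+-identityˡ _)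

negateIf-1* : (b : Bool) (x : ℤ) → negateIf b 1ℤ * x ≡ negateIf b x
negateIf-1* true x = ℤ.-1*i≡-i x
negateIf-1* false x = ℤ.*-identityˡ x

monomialEntry : Permutation′ m → (Fin m → Bool) → Fin m → Fin m → ℤ
monomialEntry ρ s i j = if isYes (ρ ⟨$⟩ʳ i ≟ j) then negateIf (s i) 1ℤ else 0ℤ

monomial : Permutation′ m → (Fin m → Bool) → Matrix m m
monomial ρ s = mk (monomialEntry ρ s)

module _ (ρ : Permutation′ m) (s : Fin m → Bool) where

  entry-monomial : (i j : Fin m) →
                     (ρ ⟨$⟩ʳ i ≡ j × entry (monomial ρ s) i j ≡ negateIf (s i) 1ℤ)
                   ⊎ (ρ ⟨$⟩ʳ i ≢ j × entry (monomial ρ s) i j ≡ 0ℤ)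
  entry-monomial i j with ρ ⟨$⟩ʳ i ≟ j | entry-mk (monomialEntry ρ s) i j
  ... | yes ρi≡j | eq = inj₁ (ρi≡j , eq)
  ... | no ρi≢j | eq = inj₂ (ρi≢j , eq)

  private
    P : Matrix m m
    P = monomial ρ s

    negateIf-1≢0 : ∀ i → negateIf (s i) 1ℤ ≢ 0ℤ
    negateIf-1≢0 i with s i
    ... | true = λ ()
    ... | false = λ ()

    nonzero⇒on : ∀ i j → entry P i j ≢ 0ℤ → ρ ⟨$⟩ʳ i ≡ j
    nonzero⇒on i j P≢0 with entry-monomial i j
    ... | inj₁ (ρi≡j , _) = ρi≡j
    ... | inj₂ (_ , P≡0) = ⊥-elim (P≢0 P≡0)

    on : ∀ i → entry P i (ρ ⟨$⟩ʳ i) ≡ negateIf (s i) 1ℤ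
    on i with entry-monomial i (ρ ⟨$⟩ʳ i)
    ... | inj₁ (_ , eq) = eq
    ... | inj₂ (ρi≢ρi , _) = ⊥-elim (ρi≢ρi refl)

    off : ∀ i j → j ≢ ρ ⟨$⟩ʳ i → entry P i j ≡ 0ℤ
    off i j j≢ρi with entry-monomial i j
    ... | inj₁ (ρi≡j , _) = ⊥-elim (j≢ρi (sym ρi≡j))
    ... | inj₂ (_ , eq) = eq

    on≢0 : ∀ i → entry P i (ρ ⟨$⟩ʳ i) ≢ 0ℤ
    on≢0 i P≡0 = negateIf-1≢0 i (trans (sym (on i)) P≡0)

  monomial-isMonomial : IsMonomial (monomial ρ s)
  monomial-isMonomial = isSign , rows , cols
    where
    isSign : ∀ i j → IsSign (entry P i j)
    isSign i j with s i | entry-monomial i j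
    ... | true | inj₁ (_ , eq) = inj₂ (inj₂ eq)
    ... | false | inj₁ (_ , eq) = inj₂ (inj₁ eq)
    ... | _ | inj₂ (_ , eq) = inj₁ eq
    rows : ∀ i → ∃ λ j → entry P i j ≢ 0ℤ × (∀ j′ → entry P i j′ ≢ 0ℤ → j′ ≡ j)
    rows i = ρ ⟨$⟩ʳ i , on≢0 i , λ j′ P≢0 → sym (nonzero⇒on i j′ P≢0)
    cols : ∀ j → ∃ λ i → entry P i j ≢ 0ℤ × (∀ i′ → entry P i′ j ≢ 0ℤ → i′ ≡ i)
    cols j =
      ρ ⟨$⟩ˡ j ,
      subst (λ j → entry P _ j ≢ 0ℤ) (Perm.inverseʳ ρ) (on≢0 (ρ ⟨$⟩ˡ j)) ,
      λ i′ P≢0 → ⟨$⟩ʳ-injective ρ (trans (nonzero⇒on i′ j P≢0) (sym (Perm.inverseʳ ρ)))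

  monomial-· : (M : Matrix m n) → monomial ρ s · M ≡ rearrangeRows ρ s M
  monomial-· M = matrix-ext λ i j → begin
    entry (monomial ρ s · M) i j
      ≡⟨ entry-mk _ i j ⟩
    sumℤ (tabulate λ l → entry P i l * entry M l j)
      ≡⟨ sumℤ-single _ (ρ ⟨$⟩ʳ i) (λ l l≢ρi → cong (_* entry M l j) (off i l l≢ρi)) ⟩
    entry P i (ρ ⟨$⟩ʳ i) * entry M (ρ ⟨$⟩ʳ i) j
      ≡⟨ cong (_* entry M (ρ ⟨$⟩ʳ i) j) (on i) ⟩
    negateIf (s i) 1ℤ * entry M (ρ ⟨$⟩ʳ i) j
      ≡⟨ negateIf-1* (s i) _ ⟩
    negateIf (s i) (entry M (ρ ⟨$⟩ʳ i) j)
      ≡⟨ entry-mk _ i j ⟨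
    entry (rearrangeRows ρ s M) i j ∎
    where open ≡-Reasoning

sign-negateIf : (x : ℤ) → IsSign x → x ≢ 0ℤ → negateIf (isYes (x ℤ.≟ -1ℤ)) 1ℤ ≡ x
sign-negateIf x (inj₁ x≡0) x≢0 = ⊥-elim (x≢0 x≡0)
sign-negateIf x (inj₂ (inj₁ refl)) _ = refl
sign-negateIf x (inj₂ (inj₂ refl)) _ = refl

isMonomial⇒monomial : (P : Matrix m m) → IsMonomial P → ∃₂ λ ρ s → P ≡ monomial ρ s
isMonomial⇒monomial {m} P (isSign , rows , cols) = ρ , s , matrix-ext P≡monomial
  where
  colOf rowOf : Fin m → Fin m
  colOf i = proj₁ (rows i)
  rowOf j = proj₁ (cols j)
  colOf≢0 : ∀ i → entry P i (colOf i) ≢ 0ℤ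
  colOf≢0 i = proj₁ (proj₂ (rows i))
  rowOf≢0 : ∀ j → entry P (rowOf j) j ≢ 0ℤ
  rowOf≢0 j = proj₁ (proj₂ (cols j))
  colOf-unique : ∀ i j → entry P i j ≢ 0ℤ → j ≡ colOf i
  colOf-unique i = proj₂ (proj₂ (rows i))
  rowOf-unique : ∀ j i → entry P i j ≢ 0ℤ → i ≡ rowOf j
  rowOf-unique j = proj₂ (proj₂ (cols j))
  ρ : Permutation′ m
  ρ = Perm.permutation colOf rowOf
        (λ j → sym (colOf-unique (rowOf j) j (rowOf≢0 j)))
        (λ i → sym (rowOf-unique (colOf i) i (colOf≢0 i)))
  s : Fin m → Bool
  s i = isYes (entry P i (colOf i) ℤ.≟ -1ℤ)
  P≡monomial : ∀ i j → entry P i j ≡ entry (monomial ρ s) i j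
  P≡monomial i j with entry-monomial ρ s i j
  ... | inj₁ (refl , eq) = trans (sym (sign-negateIf _ (isSign i j) (colOf≢0 i))) (sym eq)
  ... | inj₂ (ρi≢j , eq) with entry P i j ℤ.≟ 0ℤ
  ...   | yes P≡0 = trans P≡0 (sym eq)
  ...   | no P≢0 = ⊥-elim (ρi≢j (sym (colOf-unique i j P≢0)))

isMonomial? : (P : Matrix m m) → Dec (IsMonomial P)
isMonomial? P =
  all? (λ i → all? λ j → isSign? (entry P i j)) ×-dec
  all? (λ i → any? λ j → nonzero? i j ×-dec all? λ j′ → nonzero? i j′ →-dec (j′ ≟ j)) ×-dec
  all? (λ j → any? λ i → nonzero? i j ×-dec all? λ i′ → nonzero? i′ j →-dec (i′ ≟ i))
  where
  nonzero? : ∀ i j → Dec (entry P i j ≢ 0ℤ)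
  nonzero? i j = ¬? (entry P i j ℤ.≟ 0ℤ)
  isSign? : (x : ℤ) → Dec (IsSign x)
  isSign? x = x ℤ.≟ 0ℤ ⊎-dec x ℤ.≟ 1ℤ ⊎-dec x ℤ.≟ -1ℤ

-- The procedure MINCLASS

allVecs : {A : Set} → List A → (k : ℕ) → List (Vec A k)
allVecs xs zero = List.[ [] ]
allVecs xs (suc k) = List.cartesianProductWith _∷_ xs (allVecs xs k)

∈-allVecs : {A : Set} {xs : List A} (v : Vec A k) → (∀ i → lookup v i ∈ xs) → v ∈ allVecs xs k
∈-allVecs [] _ = here refl
∈-allVecs (x ∷ v) v∈ = ∈-cartesianProductWith⁺ _∷_ (v∈ zero) (∈-allVecs v (v∈ ∘ suc))

signs : List ℤ
signs = 0ℤ List.∷ 1ℤ List.∷ -1ℤ List.∷ List.[]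

signMatrices : (m : ℕ) → List (Matrix m m)
signMatrices m = allVecs (allVecs signs m) m

∈-signMatrices : (P : Matrix m m) → IsMonomial P → P ∈ signMatrices m
∈-signMatrices P (isSign , _) =
  ∈-allVecs P λ i → ∈-allVecs (lookup P i) λ j → sign∈signs (isSign i j)
  where
  sign∈signs : ∀ {x} → IsSign x → x ∈ signs
  sign∈signs (inj₁ refl) = here refl
  sign∈signs (inj₂ (inj₁ refl)) = there (here refl)
  sign∈signs (inj₂ (inj₂ refl)) = there (there (here refl))

module _ {m n : ℕ} (M : Matrix m n) where

  open Data.List.Extrema (≤R-totalOrder m n) using (min; argmin-sel; min≤⊤; min≤xs)

  monomialCanons : List (Matrix m n)
  monomialCanons = List.map (λ P → canon (P · M)) (List.filter isMonomial? (signMatrices m))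

  minClass : Matrix m n
  minClass = min M monomialCanons

  minClass-≤ : minClass ≤R M
  minClass-≤ = min≤⊤ M monomialCanons

  minClass-≤-canon : (P : Matrix m m) → IsMonomial P → minClass ≤R canon (P · M)
  minClass-≤-canon P P-mono =
    All.lookup (min≤xs M monomialCanons)
      (∈-map⁺ (λ P → canon (P · M)) (∈-filter⁺ isMonomial? {x = P} (∈-signMatrices P P-mono) P-mono))

  minClass-Candidate : Candidates M minClass
  minClass-Candidate with argmin-sel (λ X → X) M monomialCanons
  ... | inj₁ eq = inj₁ eq
  ... | inj₂ mem with ∈-map⁻ (λ P → canon (P · M)) mem
  ...   | P , P∈ , eq with ∈-filter⁻ isMonomial? {v = P} {xs = signMatrices m} P∈
  ...     | _ , P-mono = inj₂ (P , P-mono , eq)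

  minClass-≤-Candidates : ∀ N → Candidates M N → minClass ≤R N
  minClass-≤-Candidates N (inj₁ refl) = minClass-≤
  minClass-≤-Candidates N (inj₂ (P , P-mono , refl)) = minClass-≤-canon P P-mono

  HadEquiv-· : (P : Matrix m m) → IsMonomial P → HadEquiv M (P · M)
  HadEquiv-· P P-mono with isMonomial⇒monomial P P-mono
  ... | ρ , s , refl = subst (HadEquiv M) (sym (monomial-· ρ s M)) (HadEquiv-rearrangeRows ρ s M)

  minClass-HadEquiv : HadEquiv M minClass
  minClass-HadEquiv with minClass-Candidate
  ... | inj₁ eq = subst (HadEquiv M) (sym eq) ε
  ... | inj₂ (P , P-mono , eq) =
    subst (HadEquiv M) (sym eq) (HadEquiv-· P P-mono ◅◅ HadEquiv-canon (P · M))

  minClass-≤-HadEquiv : ∀ X → HadEquiv M X → minClass ≤R X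
  minClass-≤-HadEquiv X M~X with HadEquiv⇒Rearranged M~X
  ... | ρ , s , κ , t , refl = begin
    minClass                          ≤⟨ minClass-≤-canon (monomial ρ s) (monomial-isMonomial ρ s) ⟩
    canon (monomial ρ s · M)          ≡⟨ cong canon (monomial-· ρ s M) ⟩
    canon (rearrangeRows ρ s M)       ≡⟨ canon-rearrange ρ s κ t M ⟨
    canon (rearrange ρ s κ t M)       ≤⟨ canon-≤R _ ⟩
    rearrange ρ s κ t M               ∎
    where open ≤R-Reasoning

mainTheorem5 : ∀ {m n : ℕ} (M : Matrix m n) →
    ∃ λ N → IsLeast (Candidates M) N × IsMinClass M N
mainTheorem5 M =
  minClass M ,
  (minClass-Candidate M , minClass-≤-Candidates M) ,
  (minClass-HadEquiv M , minClass-≤-HadEquiv M)
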